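{- Let $m$ and $n$ be positive integers and let $S_n(m) = 1^n + 2^n + \dots + m^n$. Then $$v_2\big(S_n(m)\big) = \begin{cases} v_2\big(m(m+1)/2\big) & \text{if } n=1 \text{ or } n \text{ is even},\\ 2\,v_2\big(m(m+1)/2\big) & \text{if } n\ge 3 \text{ is odd}.\end{cases}$$
   Context: For a prime $p$ and a nonzero integer $k$, $v_p(k)$ denotes the largest integer $v$ such that $p^v$ divides $k$. -}

module Defs where

open import Data.Nat using (ℕ; zero; suc; _+_; _*_; _^_; _/_)
open import Data.Nat.Divisibility using (_∣_)
open import Data.Product using (_×_)
open import Relation.Nullary using (¬_)

S : ℕ → ℕ → ℕ
S n zero = 0
S n (suc m) = S n m + suc m ^ n

-- v is the p-adic valuation of k: p^v ∣ k and p^(v+1) ∤ k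
-- (for k ≠ 0 this is exactly "v = largest integer with p^v ∣ k")
IsVal : ℕ → ℕ → ℕ → Set
IsVal p k v = (p ^ v ∣ k) × ¬ (p ^ suc v ∣ k)

T : ℕ → ℕ
T m = (m * suc m) / 2

module Submission where

open import Defs
open import Data.Nat using (ℕ; suc; _*_; _≡ᵇ_; _≥_; _%_)
open import Data.Nat.Divisibility using (_∣_)
open import Data.Product using (_×_)
open import Data.Sum using (_⊎_)
open import Relation.Nullary using (¬_)
open import Relation.Binary.PropositionalEquality using (_≡_)

-- Write the even one of m, m + 1 as M = L + 1 = u·2^(j+1) with u odd; then
-- T m = m(m+1)/2 = 2^j·(odd), so v₂(T m) = j.  All estimates are congruences
-- in ℤ, and N ≡ 2^e (mod 2^(e+1)) pins down v₂(N) = e (IsVal-from-mod).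
--
-- * Even n.  By the binomial congruence (a + x)ⁿ ≡ xⁿ + n·a·xⁿ⁻¹ (mod a²), a
--   shift by a multiple of 2^(e+1) leaves xⁿ unchanged modulo 2^(e+2).  Hence
--   S n is additive on blocks of length 2^(e+1), which gives
--   S n (u·2^(e+1)) ≡ u·S n (2^(e+1)) and, by doubling, S n (2^(e+1)) ≡ 2^e.
--   So S n M ≡ 2^j (mod 2^(j+1)), and S n m ≡ S n M because Mⁿ ≡ 0 (S-even).
-- * Odd n ≥ 3.  Reading the sum backwards and pairing i with M − i gives
--   2·S n L ≡ n·M·S (n−1) L (mod M²); the even case for n − 1 then yields
--   S n L ≡ 4^j (mod 2^(2j+1)) (S-odd).
-- * n = 1 is Gauss' formula S 1 m = T m.

open import Data.Nat using (zero; _+_; _^_; _≤_; _<_; s≤s; z≤n)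
import Data.Nat.Properties as ℕ
import Data.Nat.Divisibility as ℕ∣
open import Data.Nat.DivMod using (_/_; m*n/n≡m)
open import Data.Nat.Induction using (<-rec)
open import Data.Nat.Tactic.RingSolver as ℕ-Ring using ()
open import Data.Integer.Base using (ℤ; +_; -_; 0ℤ; 1ℤ)
  renaming (_+_ to _+ᶻ_; _*_ to _*ᶻ_; _-_ to _-ᶻ_; _^_ to _^ᶻ_)
import Data.Integer.Properties as ℤ
open import Data.Integer.Divisibility.Signed
  using (divides; ∣ᵤ⇒∣; ∣⇒∣ᵤ; ∣-refl; ∣-trans; ∣-reflexive; ∣m∣n⇒∣m+n; ∣m⇒∣-m; ∣n⇒∣m*n; ∣m⇒∣m*n;
         *-monoʳ-∣; *-cancelˡ-∣)
  renaming (_∣_ to _∣ᶻ_)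
open import Data.Integer.Tactic.RingSolver using (solve-∀)
open import Data.Product using (∃; ∃₂; _,_)
open import Data.Sum using (inj₁; inj₂)
open import Data.Empty using (⊥-elim)
open import Relation.Binary.Bundles using (Setoid)
open import Relation.Binary.Definitions using (tri<; tri≈; tri>)
open import Relation.Binary.PropositionalEquality using (refl; sym; trans; cong; cong₂; subst; module ≡-Reasoning)
import Relation.Binary.Reasoning.Setoid as SetoidReasoning
open import Function using (_∘_)

infix 4 _≡_[mod_]
record _≡_[mod_] (x y d : ℤ) : Set where
  constructor mod-by
  field divides-difference : d ∣ᶻ x -ᶻ y

mod-reflexive : ∀ {d x y} → x ≡ y → x ≡ y [mod d ]
mod-reflexive {x = x} refl = mod-by (divides 0ℤ (ℤ.+-inverseʳ x))

mod-refl : ∀ {d} x → x ≡ x [mod d ]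
mod-refl x = mod-reflexive refl

mod-sym : ∀ {d x y} → x ≡ y [mod d ] → y ≡ x [mod d ]
mod-sym {x = x} {y} (mod-by p) = mod-by (subst (_ ∣ᶻ_) (negate x y) (∣m⇒∣-m p))
  where
  negate : ∀ x y → - (x -ᶻ y) ≡ y -ᶻ x
  negate = solve-∀

mod-trans : ∀ {d x y z} → x ≡ y [mod d ] → y ≡ z [mod d ] → x ≡ z [mod d ]
mod-trans {x = x} {y} {z} (mod-by p) (mod-by q) = mod-by (subst (_ ∣ᶻ_) (telescope x y z) (∣m∣n⇒∣m+n p q))
  where
  telescope : ∀ x y z → (x -ᶻ y) +ᶻ (y -ᶻ z) ≡ x -ᶻ z
  telescope = solve-∀

mod-+ : ∀ {d x y u v} → x ≡ y [mod d ] → u ≡ v [mod d ] → x +ᶻ u ≡ y +ᶻ v [mod d ]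
mod-+ {x = x} {y} {u} {v} (mod-by p) (mod-by q) = mod-by (subst (_ ∣ᶻ_) (regroup x y u v) (∣m∣n⇒∣m+n p q))
  where
  regroup : ∀ x y u v → (x -ᶻ y) +ᶻ (u -ᶻ v) ≡ (x +ᶻ u) -ᶻ (y +ᶻ v)
  regroup = solve-∀

mod-*ˡ : ∀ {d x y} c → x ≡ y [mod d ] → c *ᶻ x ≡ c *ᶻ y [mod d ]
mod-*ˡ {x = x} {y} c (mod-by p) = mod-by (subst (_ ∣ᶻ_) (distrib c x y) (∣n⇒∣m*n c p))
  where
  distrib : ∀ c x y → c *ᶻ (x -ᶻ y) ≡ c *ᶻ x -ᶻ c *ᶻ y
  distrib = solve-∀

mod-scale : ∀ {d x y} c → x ≡ y [mod d ] → c *ᶻ x ≡ c *ᶻ y [mod c *ᶻ d ]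
mod-scale {x = x} {y} c (mod-by p) = mod-by (subst (_ ∣ᶻ_) (distrib c x y) (*-monoʳ-∣ c p))
  where
  distrib : ∀ c x y → c *ᶻ (x -ᶻ y) ≡ c *ᶻ x -ᶻ c *ᶻ y
  distrib = solve-∀

mod-halve : ∀ {d x y} → + 2 *ᶻ x ≡ + 2 *ᶻ y [mod + 2 *ᶻ d ] → x ≡ y [mod d ]
mod-halve {x = x} {y} (mod-by p) = mod-by (*-cancelˡ-∣ (+ 2) (subst (_ ∣ᶻ_) (factor x y) p))
  where
  factor : ∀ x y → + 2 *ᶻ x -ᶻ + 2 *ᶻ y ≡ + 2 *ᶻ (x -ᶻ y)
  factor = solve-∀

mod-weaken : ∀ {d e x y} → e ∣ᶻ d → x ≡ y [mod d ] → x ≡ y [mod e ]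
mod-weaken e∣d (mod-by p) = mod-by (∣-trans e∣d p)

mod-modulus : ∀ {d e x y} → d ≡ e → x ≡ y [mod d ] → x ≡ y [mod e ]
mod-modulus d≡e = mod-weaken (∣-reflexive (sym d≡e))

mod-absorb : ∀ {d} x {k} → d ∣ᶻ k → x +ᶻ k ≡ x [mod d ]
mod-absorb x {k} d∣k = mod-by (subst (_ ∣ᶻ_) (cancel x k) d∣k)
  where
  cancel : ∀ x k → k ≡ x +ᶻ k -ᶻ x
  cancel = solve-∀

mod-setoid : ℤ → Setoid _ _
mod-setoid d = record
  { Carrier = ℤ
  ; _≈_ = λ x y → x ≡ y [mod d ]
  ; isEquivalence = record { refl = mod-refl _ ; sym = mod-sym ; trans = mod-trans }
  }

module ModReasoning (d : ℤ) = SetoidReasoning (mod-setoid d)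

pow₂ : ℕ → ℤ
pow₂ e = (+ 2) ^ᶻ e

pos-^ : ∀ a n → + (a ^ n) ≡ (+ a) ^ᶻ n
pos-^ a zero = refl
pos-^ a (suc n) = trans (ℤ.pos-* a (a ^ n)) (cong (+ a *ᶻ_) (pos-^ a n))

^-monoʳ-∣ : ∀ p {m n} → m ≤ n → p ^ m ∣ p ^ n
^-monoʳ-∣ p {n = n} z≤n = ℕ∣.1∣ (p ^ n)
^-monoʳ-∣ p (s≤s m≤n) = ℕ∣.*-monoʳ-∣ p (^-monoʳ-∣ p m≤n)

IsVal-unique : ∀ {p k a b} → IsVal p k a → IsVal p k b → a ≡ b
IsVal-unique {p} {a = a} {b} (pᵃ∣k , pᵃ⁺¹∤k) (pᵇ∣k , pᵇ⁺¹∤k) with ℕ.<-cmp a b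
... | tri< a<b _ _ = ⊥-elim (pᵃ⁺¹∤k (ℕ∣.∣-trans (^-monoʳ-∣ p a<b) pᵇ∣k))
... | tri≈ _ a≡b _ = a≡b
... | tri> _ _ b<a = ⊥-elim (pᵇ⁺¹∤k (ℕ∣.∣-trans (^-monoʳ-∣ p b<a) pᵃ∣k))

IsVal-from-mod : ∀ {N} e → + N ≡ pow₂ e [mod pow₂ (suc e) ] → IsVal 2 N e
IsVal-from-mod {N} e (mod-by 2E∣N-E) = 2ᵉ∣N , 2ᵉ⁺¹∤N
  where
  E = pow₂ e
  toℕ : ∀ k {x} → pow₂ k ∣ᶻ + x → 2 ^ k ∣ x
  toℕ k = ∣⇒∣ᵤ ∘ subst (_∣ᶻ _) (sym (pos-^ 2 k))
  fromℕ : ∀ k {x} → 2 ^ k ∣ x → pow₂ k ∣ᶻ + x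
  fromℕ k = subst (_∣ᶻ _) (pos-^ 2 k) ∘ ∣ᵤ⇒∣
  add-back : ∀ n E → (n -ᶻ E) +ᶻ E ≡ n
  add-back = solve-∀
  take-away : ∀ n E → n -ᶻ (n -ᶻ E) ≡ E
  take-away = solve-∀
  2ᵉ∣N : 2 ^ e ∣ N
  2ᵉ∣N = toℕ e (subst (_∣ᶻ_ _) (add-back (+ N) E)
                (∣m∣n⇒∣m+n (∣-trans (divides (+ 2) refl) 2E∣N-E) ∣-refl))
  2ᵉ⁺¹∤N : ¬ (2 ^ suc e ∣ N)
  2ᵉ⁺¹∤N 2ᵉ⁺¹∣N = ℕ.<⇒≱ (ℕ.^-monoʳ-< 2 (s≤s (s≤s z≤n)) (ℕ.n<1+n e)) (ℕ∣.∣⇒≤ {{ℕ.m^n≢0 2 e}} 2ᵉ⁺¹∣2ᵉ)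
    where
    2ᵉ⁺¹∣2ᵉ : 2 ^ suc e ∣ 2 ^ e
    2ᵉ⁺¹∣2ᵉ = toℕ (suc e) (subst (_∣ᶻ_ _) (trans (take-away (+ N) E) (sym (pos-^ 2 e)))
                    (∣m∣n⇒∣m+n (fromℕ (suc e) 2ᵉ⁺¹∣N) (∣m⇒∣-m 2E∣N-E)))

S-suc : ∀ n L → + S n (suc L) ≡ + S n L +ᶻ (+ suc L) ^ᶻ n
S-suc n L = trans (ℤ.pos-+ (S n L) (suc L ^ n)) (cong (+ S n L +ᶻ_) (pos-^ (suc L) n))

binomial : ∀ a x k → (a +ᶻ x) ^ᶻ suc k ≡ x ^ᶻ suc k +ᶻ + suc k *ᶻ a *ᶻ x ^ᶻ k [mod a *ᶻ a ]
binomial a x zero = mod-reflexive (linear a x)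
  where
  linear : ∀ a x → (a +ᶻ x) *ᶻ 1ℤ ≡ x *ᶻ 1ℤ +ᶻ + 1 *ᶻ a *ᶻ 1ℤ
  linear = solve-∀
binomial a x (suc k) = begin
  (a +ᶻ x) *ᶻ (a +ᶻ x) ^ᶻ suc k
    ≈⟨ mod-*ˡ (a +ᶻ x) (binomial a x k) ⟩
  (a +ᶻ x) *ᶻ (x ^ᶻ suc k +ᶻ + suc k *ᶻ a *ᶻ x ^ᶻ k)
    ≡⟨ expand a x (x ^ᶻ k) (+ k) ⟩
  x ^ᶻ suc (suc k) +ᶻ + suc (suc k) *ᶻ a *ᶻ x ^ᶻ suc k +ᶻ (+ suc k *ᶻ x ^ᶻ k) *ᶻ (a *ᶻ a)
    ≈⟨ mod-absorb _ (∣n⇒∣m*n (+ suc k *ᶻ x ^ᶻ k) ∣-refl) ⟩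
  x ^ᶻ suc (suc k) +ᶻ + suc (suc k) *ᶻ a *ᶻ x ^ᶻ suc k ∎
  where
  open ModReasoning (a *ᶻ a)
  expand : ∀ a x p k → (a +ᶻ x) *ᶻ (x *ᶻ p +ᶻ (+ 1 +ᶻ k) *ᶻ a *ᶻ p)
         ≡ x *ᶻ (x *ᶻ p) +ᶻ (+ 1 +ᶻ (+ 1 +ᶻ k)) *ᶻ a *ᶻ (x *ᶻ p) +ᶻ ((+ 1 +ᶻ k) *ᶻ p) *ᶻ (a *ᶻ a)
  expand = solve-∀

record ShiftInvariant (n c : ℕ) (d : ℤ) : Set where
  constructor shift-invariance
  field shift : ∀ x → (+ c +ᶻ x) ^ᶻ n ≡ x ^ᶻ n [mod d ]
open ShiftInvariant

shift-invariant : ∀ {d} n c → d ∣ᶻ + n *ᶻ + c → d ∣ᶻ + c *ᶻ + c → ShiftInvariant n c d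
shift-invariant zero c _ _ = shift-invariance λ _ → mod-refl 1ℤ
shift-invariant {d} (suc k) c d∣nc d∣c² = shift-invariance λ x → let open ModReasoning d in begin
  (+ c +ᶻ x) ^ᶻ suc k                          ≈⟨ mod-weaken d∣c² (binomial (+ c) x k) ⟩
  x ^ᶻ suc k +ᶻ + suc k *ᶻ + c *ᶻ x ^ᶻ k        ≈⟨ mod-absorb _ (∣m⇒∣m*n (x ^ᶻ k) d∣nc) ⟩
  x ^ᶻ suc k                                   ∎

even-shift : ∀ {n c} D → 2 ∣ n → + 2 *ᶻ D ∣ᶻ + c → ShiftInvariant n c (+ 2 *ᶻ (+ 2 *ᶻ D))
even-shift {n} {c} D (ℕ∣.divides q n≡q*2) (divides Q c≡Q*2D) = shift-invariant n c
  (divides (+ q *ᶻ Q) (begin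
    + n *ᶻ + c                    ≡⟨ cong₂ _*ᶻ_ (trans (cong +_ n≡q*2) (ℤ.pos-* q 2)) c≡Q*2D ⟩
    + q *ᶻ + 2 *ᶻ (Q *ᶻ (+ 2 *ᶻ D)) ≡⟨ nc-form (+ q) Q D ⟩
    + q *ᶻ Q *ᶻ (+ 2 *ᶻ (+ 2 *ᶻ D)) ∎))
  (divides (Q *ᶻ Q *ᶻ D) (begin
    + c *ᶻ + c                                 ≡⟨ cong₂ _*ᶻ_ c≡Q*2D c≡Q*2D ⟩
    Q *ᶻ (+ 2 *ᶻ D) *ᶻ (Q *ᶻ (+ 2 *ᶻ D))          ≡⟨ c²-form Q D ⟩
    Q *ᶻ Q *ᶻ D *ᶻ (+ 2 *ᶻ (+ 2 *ᶻ D)) ∎))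
  where
  open ≡-Reasoning
  nc-form : ∀ q Q D → q *ᶻ + 2 *ᶻ (Q *ᶻ (+ 2 *ᶻ D)) ≡ q *ᶻ Q *ᶻ (+ 2 *ᶻ (+ 2 *ᶻ D))
  nc-form = solve-∀
  c²-form : ∀ Q D → Q *ᶻ (+ 2 *ᶻ D) *ᶻ (Q *ᶻ (+ 2 *ᶻ D)) ≡ Q *ᶻ Q *ᶻ D *ᶻ (+ 2 *ᶻ (+ 2 *ᶻ D))
  c²-form = solve-∀

S-additive : ∀ {n c d} → ShiftInvariant n c d → ∀ L → + S n (c + L) ≡ + S n c +ᶻ + S n L [mod d ]
S-additive {n} {c} inv zero =
  mod-reflexive (trans (cong (+_ ∘ S n) (ℕ.+-identityʳ c)) (sym (ℤ.+-identityʳ (+ S n c))))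
S-additive {n} {c} {d} inv (suc L) = begin
  + S n (c + suc L)                                 ≡⟨ cong (+_ ∘ S n) (ℕ.+-suc c L) ⟩
  + S n (suc (c + L))                               ≡⟨ S-suc n (c + L) ⟩
  + S n (c + L) +ᶻ (+ suc (c + L)) ^ᶻ n              ≡⟨ cong (λ y → + S n (c + L) +ᶻ (+ y) ^ᶻ n) (sym (ℕ.+-suc c L)) ⟩
  + S n (c + L) +ᶻ (+ c +ᶻ + suc L) ^ᶻ n             ≈⟨ mod-+ (S-additive inv L) (shift inv (+ suc L)) ⟩
  + S n c +ᶻ + S n L +ᶻ (+ suc L) ^ᶻ n              ≡⟨ ℤ.+-assoc (+ S n c) (+ S n L) ((+ suc L) ^ᶻ n) ⟩
  + S n c +ᶻ (+ S n L +ᶻ (+ suc L) ^ᶻ n)            ≡⟨ cong (+ S n c +ᶻ_) (sym (S-suc n L)) ⟩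
  + S n c +ᶻ + S n (suc L)                          ∎
  where open ModReasoning d

S-multiple : ∀ {n a d} → ShiftInvariant n a d → ∀ u → + S n (u * a) ≡ + u *ᶻ + S n a [mod d ]
S-multiple inv zero = mod-refl 0ℤ
S-multiple {n} {a} {d} inv (suc u) = begin
  + S n (a + u * a)             ≈⟨ S-additive inv (u * a) ⟩
  + S n a +ᶻ + S n (u * a)      ≈⟨ mod-+ (mod-refl (+ S n a)) (S-multiple {n} {a} {d} inv u) ⟩
  + S n a +ᶻ + u *ᶻ + S n a     ≡⟨ collect (+ S n a) (+ u) ⟩
  + suc u *ᶻ + S n a            ∎
  where
  open ModReasoning d
  collect : ∀ s u → s +ᶻ u *ᶻ s ≡ (+ 1 +ᶻ u) *ᶻ s
  collect = solve-∀

odd-multiple : ∀ W X → (1ℤ +ᶻ + 2 *ᶻ W) *ᶻ X ≡ X [mod + 2 *ᶻ X ]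
odd-multiple W X = mod-by (divides W (excess W X))
  where
  excess : ∀ W X → (1ℤ +ᶻ + 2 *ᶻ W) *ᶻ X -ᶻ X ≡ W *ᶻ (+ 2 *ᶻ X)
  excess = solve-∀

odd-cast : ∀ w → + suc (2 * w) ≡ 1ℤ +ᶻ + 2 *ᶻ + w
odd-cast w = cong (1ℤ +ᶻ_) (ℤ.pos-* 2 w)

pow₂-shift : ∀ {n} → 2 ∣ n → ∀ e → ShiftInvariant n (2 ^ suc e) (pow₂ (suc (suc e)))
pow₂-shift 2∣n e = even-shift (pow₂ e) 2∣n (∣-reflexive (sym (pos-^ 2 (suc e))))

-- For even n ≥ 1: S n (2^(e+1)) ≡ 2^e (mod 2^(e+1)), by doubling the block.
S-pow₂ : ∀ {n} → 2 ∣ n → 1 ≤ n → ∀ e → + S n (2 ^ suc e) ≡ pow₂ e [mod pow₂ (suc e) ]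
S-pow₂ {suc n} _ _ zero = begin
  + S (suc n) 2              ≡⟨ cong (λ y → + (y + 2 ^ suc n)) (ℕ.^-zeroˡ (suc n)) ⟩
  1ℤ +ᶻ + (2 ^ suc n)        ≈⟨ mod-absorb 1ℤ (∣ᵤ⇒∣ {+ 2} {+ (2 ^ suc n)} (ℕ∣.m∣m*n (2 ^ n))) ⟩
  1ℤ                         ∎
  where open ModReasoning (+ 2)
S-pow₂ {n} 2∣n 1≤n (suc e) = begin
  + S n (2 * 2 ^ suc e)      ≈⟨ S-multiple (pow₂-shift {n} 2∣n e) 2 ⟩
  + 2 *ᶻ + S n (2 ^ suc e)   ≈⟨ mod-scale (+ 2) (S-pow₂ 2∣n 1≤n e) ⟩
  + 2 *ᶻ pow₂ e              ∎
  where open ModReasoning (pow₂ (suc (suc e)))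

S-even-top : ∀ {n} → 2 ∣ n → 1 ≤ n → ∀ j w → + S n (suc (2 * w) * 2 ^ suc j) ≡ pow₂ j [mod pow₂ (suc j) ]
S-even-top {n} 2∣n 1≤n j w = begin
  + S n (u * 2 ^ suc j)         ≈⟨ mod-weaken (∣n⇒∣m*n (+ 2) ∣-refl) (S-multiple (pow₂-shift {n} 2∣n j) u) ⟩
  + u *ᶻ + S n (2 ^ suc j)      ≈⟨ mod-*ˡ (+ u) (S-pow₂ 2∣n 1≤n j) ⟩
  + u *ᶻ pow₂ j                 ≡⟨ cong (_*ᶻ pow₂ j) (odd-cast w) ⟩
  (1ℤ +ᶻ + 2 *ᶻ + w) *ᶻ pow₂ j  ≈⟨ odd-multiple (+ w) (pow₂ j) ⟩
  pow₂ j                        ∎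
  where
  open ModReasoning (pow₂ (suc j))
  u = suc (2 * w)

S-pred : ∀ {d} n L → d ∣ᶻ (+ suc L) ^ᶻ n → + S n (suc L) ≡ + S n L [mod d ]
S-pred n L d∣Mⁿ = mod-trans (mod-reflexive (S-suc n L)) (mod-absorb (+ S n L) d∣Mⁿ)

S-near : ∀ {d n m L} → d ∣ᶻ (+ suc L) ^ᶻ n → m ≡ L ⊎ m ≡ suc L → + S n m ≡ + S n L [mod d ]
S-near _ (inj₁ refl) = mod-refl _
S-near {n = n} {L = L} d∣Mⁿ (inj₂ refl) = S-pred n L d∣Mⁿ

record OddTimesPow₂ (M j : ℕ) : Set where
  constructor odd-times-pow₂
  field
    w : ℕ
    factorisation : M ≡ suc (2 * w) * 2 ^ suc j
open OddTimesPow₂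

factorisation-ℤ : ∀ {M j} (f : OddTimesPow₂ M j) → + M ≡ (1ℤ +ᶻ + 2 *ᶻ + w f) *ᶻ (+ 2 *ᶻ pow₂ j)
factorisation-ℤ {j = j} (odd-times-pow₂ w M≡u2ʲ⁺¹) =
  trans (cong +_ M≡u2ʲ⁺¹) (trans (ℤ.pos-* (suc (2 * w)) (2 ^ suc j)) (cong₂ _*ᶻ_ (odd-cast w) (pos-^ 2 (suc j))))

S-even : ∀ {n m L j} → 2 ∣ n → 1 ≤ n → OddTimesPow₂ (suc L) j → m ≡ L ⊎ m ≡ suc L →
         + S n m ≡ pow₂ j [mod pow₂ (suc j) ]
S-even {n@(suc n-1)} {m} {L} {j} 2∣n 1≤n f@(odd-times-pow₂ w M≡u2ʲ⁺¹) adjacent = begin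
  + S n m                   ≈⟨ S-near 2ʲ⁺¹∣Mⁿ adjacent ⟩
  + S n L                   ≈⟨ mod-sym (S-pred n L 2ʲ⁺¹∣Mⁿ) ⟩
  + S n (suc L)             ≡⟨ cong (+_ ∘ S n) M≡u2ʲ⁺¹ ⟩
  + S n (suc (2 * w) * 2 ^ suc j) ≈⟨ S-even-top 2∣n 1≤n j w ⟩
  pow₂ j                    ∎
  where
  open ModReasoning (pow₂ (suc j))
  2ʲ⁺¹∣Mⁿ : pow₂ (suc j) ∣ᶻ (+ suc L) ^ᶻ n
  2ʲ⁺¹∣Mⁿ = ∣m⇒∣m*n ((+ suc L) ^ᶻ n-1) (divides (1ℤ +ᶻ + 2 *ᶻ + w) (factorisation-ℤ f))

sumTo : (ℕ → ℤ) → ℕ → ℤ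
sumTo f zero = 0ℤ
sumTo f (suc L) = sumTo f L +ᶻ f (suc L)

S-as-sum : ∀ n L → + S n L ≡ sumTo (λ i → (+ i) ^ᶻ n) L
S-as-sum n zero = refl
S-as-sum n (suc L) = trans (S-suc n L) (cong (_+ᶻ (+ suc L) ^ᶻ n) (S-as-sum n L))

sumTo-cong : ∀ {f g} → (∀ i → f i ≡ g i) → ∀ L → sumTo f L ≡ sumTo g L
sumTo-cong f≡g zero = refl
sumTo-cong f≡g (suc L) = cong₂ _+ᶻ_ (sumTo-cong f≡g L) (f≡g (suc L))

sumTo-mod : ∀ {d f g} → (∀ i → f i ≡ g i [mod d ]) → ∀ L → sumTo f L ≡ sumTo g L [mod d ]
sumTo-mod f≡g zero = mod-refl 0ℤ
sumTo-mod f≡g (suc L) = mod-+ (sumTo-mod f≡g L) (f≡g (suc L))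

sumTo-+ : ∀ f g L → sumTo (λ i → f i +ᶻ g i) L ≡ sumTo f L +ᶻ sumTo g L
sumTo-+ f g zero = refl
sumTo-+ f g (suc L) = trans (cong (_+ᶻ (f (suc L) +ᶻ g (suc L))) (sumTo-+ f g L))
                            (interchange (sumTo f L) (sumTo g L) (f (suc L)) (g (suc L)))
  where
  interchange : ∀ a b c d → a +ᶻ b +ᶻ (c +ᶻ d) ≡ a +ᶻ c +ᶻ (b +ᶻ d)
  interchange = solve-∀

sumTo-*ˡ : ∀ c f L → sumTo (λ i → c *ᶻ f i) L ≡ c *ᶻ sumTo f L
sumTo-*ˡ c f zero = sym (ℤ.*-zeroʳ c)
sumTo-*ˡ c f (suc L) = trans (cong (_+ᶻ c *ᶻ f (suc L)) (sumTo-*ˡ c f L))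
                             (sym (ℤ.*-distribˡ-+ c (sumTo f L) (f (suc L))))

sumTo-peel : ∀ f L → sumTo f (suc L) ≡ f 1 +ᶻ sumTo (f ∘ suc) L
sumTo-peel f zero = ℤ.+-comm 0ℤ (f 1)
sumTo-peel f (suc L) = trans (cong (_+ᶻ f (suc (suc L))) (sumTo-peel f L))
                             (ℤ.+-assoc (f 1) (sumTo (f ∘ suc) L) (f (suc (suc L))))

sumTo-reflect : ∀ g L → sumTo (λ i → g (+ suc L -ᶻ + i)) L ≡ sumTo (λ i → g (+ i)) L
sumTo-reflect g zero = refl
sumTo-reflect g (suc L) = begin
  sumTo (λ i → g (+ suc (suc L) -ᶻ + i)) (suc L)
    ≡⟨ sumTo-peel (λ i → g (+ suc (suc L) -ᶻ + i)) L ⟩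
  g (+ suc (suc L) -ᶻ + 1) +ᶻ sumTo (λ i → g (+ suc (suc L) -ᶻ + suc i)) L
    ≡⟨ cong₂ _+ᶻ_ (cong g (drop-one (+ suc L))) (sumTo-cong (λ i → cong g (drop-ones (+ suc L) (+ i))) L) ⟩
  g (+ suc L) +ᶻ sumTo (λ i → g (+ suc L -ᶻ + i)) L
    ≡⟨ cong (g (+ suc L) +ᶻ_) (sumTo-reflect g L) ⟩
  g (+ suc L) +ᶻ sumTo (λ i → g (+ i)) L
    ≡⟨ ℤ.+-comm (g (+ suc L)) _ ⟩
  sumTo (λ i → g (+ i)) (suc L) ∎
  where
  open ≡-Reasoning
  drop-one : ∀ x → (+ 1 +ᶻ x) -ᶻ + 1 ≡ x
  drop-one = solve-∀
  drop-ones : ∀ x y → (+ 1 +ᶻ x) -ᶻ (+ 1 +ᶻ y) ≡ x -ᶻ y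
  drop-ones = solve-∀

neg-^-even : ∀ x {k} → 2 ∣ k → (- x) ^ᶻ k ≡ x ^ᶻ k
neg-^-even x (ℕ∣.divides q refl) = begin
  (- x) ^ᶻ (q * 2)     ≡⟨ cong ((- x) ^ᶻ_) (ℕ.*-comm q 2) ⟩
  (- x) ^ᶻ (2 * q)     ≡⟨ sym (ℤ.^-*-assoc (- x) 2 q) ⟩
  ((- x) ^ᶻ 2) ^ᶻ q    ≡⟨ cong (_^ᶻ q) (square x) ⟩
  (x ^ᶻ 2) ^ᶻ q        ≡⟨ ℤ.^-*-assoc x 2 q ⟩
  x ^ᶻ (2 * q)         ≡⟨ cong (x ^ᶻ_) (ℕ.*-comm 2 q) ⟩
  x ^ᶻ (q * 2)         ∎
  where
  open ≡-Reasoning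
  square : ∀ x → (- x) *ᶻ ((- x) *ᶻ 1ℤ) ≡ x *ᶻ (x *ᶻ 1ℤ)
  square = solve-∀

reflected-power : ∀ {k} → 2 ∣ k → ∀ M x → x ^ᶻ suc k +ᶻ (M -ᶻ x) ^ᶻ suc k ≡ + suc k *ᶻ M *ᶻ x ^ᶻ k [mod M *ᶻ M ]
reflected-power {k} 2∣k M x = begin
  x ^ᶻ suc k +ᶻ (M +ᶻ - x) ^ᶻ suc k
    ≈⟨ mod-+ (mod-refl (x ^ᶻ suc k)) (binomial M (- x) k) ⟩
  x ^ᶻ suc k +ᶻ ((- x) *ᶻ (- x) ^ᶻ k +ᶻ + suc k *ᶻ M *ᶻ (- x) ^ᶻ k)
    ≡⟨ cong (λ p → x ^ᶻ suc k +ᶻ ((- x) *ᶻ p +ᶻ + suc k *ᶻ M *ᶻ p)) (neg-^-even x 2∣k) ⟩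
  x *ᶻ x ^ᶻ k +ᶻ ((- x) *ᶻ x ^ᶻ k +ᶻ + suc k *ᶻ M *ᶻ x ^ᶻ k)
    ≡⟨ cancel x (x ^ᶻ k) (+ suc k *ᶻ M) ⟩
  + suc k *ᶻ M *ᶻ x ^ᶻ k ∎
  where
  open ModReasoning (M *ᶻ M)
  cancel : ∀ x p c → x *ᶻ p +ᶻ ((- x) *ᶻ p +ᶻ c *ᶻ p) ≡ c *ᶻ p
  cancel = solve-∀

-- Pairing i with M − i (M = L + 1): for odd n = k + 1, 2·S n L ≡ n·M·S k L (mod M²).
pairing : ∀ {k} → 2 ∣ k → ∀ L →
          + S (suc k) L +ᶻ + S (suc k) L ≡ + suc k *ᶻ + suc L *ᶻ + S k L [mod + suc L *ᶻ + suc L ]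
pairing {k} 2∣k L = begin
  + S n L +ᶻ + S n L
    ≡⟨ cong₂ _+ᶻ_ (S-as-sum n L) (trans (S-as-sum n L) (sym (sumTo-reflect (_^ᶻ n) L))) ⟩
  sumTo (λ i → (+ i) ^ᶻ n) L +ᶻ sumTo (λ i → (M -ᶻ + i) ^ᶻ n) L
    ≡⟨ sym (sumTo-+ (λ i → (+ i) ^ᶻ n) (λ i → (M -ᶻ + i) ^ᶻ n) L) ⟩
  sumTo (λ i → (+ i) ^ᶻ n +ᶻ (M -ᶻ + i) ^ᶻ n) L
    ≈⟨ sumTo-mod (λ i → reflected-power 2∣k M (+ i)) L ⟩
  sumTo (λ i → + n *ᶻ M *ᶻ (+ i) ^ᶻ k) L
    ≡⟨ sumTo-*ˡ (+ n *ᶻ M) (λ i → (+ i) ^ᶻ k) L ⟩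
  + n *ᶻ M *ᶻ sumTo (λ i → (+ i) ^ᶻ k) L
    ≡⟨ cong (+ n *ᶻ M *ᶻ_) (sym (S-as-sum k L)) ⟩
  + n *ᶻ M *ᶻ + S k L ∎
  where
  n = suc k
  M = + suc L
  open ModReasoning (M *ᶻ M)

square-∣ : ∀ {M j} → OddTimesPow₂ M j → + 2 *ᶻ (+ 2 *ᶻ (pow₂ j *ᶻ pow₂ j)) ∣ᶻ + M *ᶻ + M
square-∣ {j = j} f = divides (U *ᶻ U) (trans (cong₂ _*ᶻ_ M≡U2E M≡U2E) (square U (pow₂ j)))
  where
  U = 1ℤ +ᶻ + 2 *ᶻ + w f
  M≡U2E = factorisation-ℤ f
  square : ∀ U E → U *ᶻ (+ 2 *ᶻ E) *ᶻ (U *ᶻ (+ 2 *ᶻ E)) ≡ U *ᶻ U *ᶻ (+ 2 *ᶻ (+ 2 *ᶻ (E *ᶻ E)))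
  square = solve-∀

-- Odd n = k + 1 ≥ 3 and M = L + 1 = u·2^(j+1): S n L ≡ (2^j)² (mod 2·(2^j)²).
-- The pairing congruence, taken modulo 4·(2^j)², reduces this to S k L ≡ 2^j (mod 2^(j+1)).
S-odd-below : ∀ {k L j} → 2 ∣ k → 1 ≤ k → OddTimesPow₂ (suc L) j →
              + S (suc k) L ≡ pow₂ j *ᶻ pow₂ j [mod + 2 *ᶻ (pow₂ j *ᶻ pow₂ j) ]
S-odd-below {k} {L} {j} 2∣k@(ℕ∣.divides q k≡q*2) 1≤k f = mod-halve (begin
  + 2 *ᶻ + S n L                                 ≡⟨ double (+ S n L) ⟩
  + S n L +ᶻ + S n L                             ≈⟨ mod-weaken (square-∣ f) (pairing 2∣k L) ⟩
  + n *ᶻ + suc L *ᶻ Sₖ                           ≡⟨ cong₂ (λ a b → a *ᶻ b *ᶻ Sₖ) n-odd (factorisation-ℤ f) ⟩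
  (1ℤ +ᶻ + 2 *ᶻ Q) *ᶻ (U *ᶻ (+ 2 *ᶻ E)) *ᶻ Sₖ    ≡⟨ regroup Q W E Sₖ ⟩
  (1ℤ +ᶻ + 2 *ᶻ Z) *ᶻ ((+ 2 *ᶻ E) *ᶻ Sₖ)          ≈⟨ mod-*ˡ (1ℤ +ᶻ + 2 *ᶻ Z) (mod-modulus (scaled E) (mod-scale (+ 2 *ᶻ E) Sₖ≡E)) ⟩
  (1ℤ +ᶻ + 2 *ᶻ Z) *ᶻ ((+ 2 *ᶻ E) *ᶻ E)           ≈⟨ mod-modulus (doubled E) (odd-multiple Z ((+ 2 *ᶻ E) *ᶻ E)) ⟩
  (+ 2 *ᶻ E) *ᶻ E                                ≡⟨ ℤ.*-assoc (+ 2) E E ⟩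
  + 2 *ᶻ (E *ᶻ E)                                ∎)
  where
  n = suc k
  E = pow₂ j
  Q = + q
  W = + w f
  U = 1ℤ +ᶻ + 2 *ᶻ W
  Z = Q +ᶻ W +ᶻ + 2 *ᶻ Q *ᶻ W
  Sₖ = + S k L
  open ModReasoning (+ 2 *ᶻ (+ 2 *ᶻ (E *ᶻ E)))
  Sₖ≡E : Sₖ ≡ E [mod + 2 *ᶻ E ]
  Sₖ≡E = S-even 2∣k 1≤k f (inj₁ refl)
  n-odd : + n ≡ 1ℤ +ᶻ + 2 *ᶻ Q
  n-odd = trans (cong (+_ ∘ suc) (trans k≡q*2 (ℕ.*-comm q 2))) (odd-cast q)
  double : ∀ s → + 2 *ᶻ s ≡ s +ᶻ s
  double = solve-∀
  regroup : ∀ Q W E s → (1ℤ +ᶻ + 2 *ᶻ Q) *ᶻ ((1ℤ +ᶻ + 2 *ᶻ W) *ᶻ (+ 2 *ᶻ E)) *ᶻ s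
          ≡ (1ℤ +ᶻ + 2 *ᶻ (Q +ᶻ W +ᶻ + 2 *ᶻ Q *ᶻ W)) *ᶻ ((+ 2 *ᶻ E) *ᶻ s)
  regroup = solve-∀
  scaled : ∀ E → (+ 2 *ᶻ E) *ᶻ (+ 2 *ᶻ E) ≡ + 2 *ᶻ (+ 2 *ᶻ (E *ᶻ E))
  scaled = solve-∀
  doubled : ∀ E → + 2 *ᶻ ((+ 2 *ᶻ E) *ᶻ E) ≡ + 2 *ᶻ (+ 2 *ᶻ (E *ᶻ E))
  doubled = solve-∀

S-odd : ∀ {k m L j} → 2 ∣ k → 1 ≤ k → OddTimesPow₂ (suc L) j → m ≡ L ⊎ m ≡ suc L →
        + S (suc k) m ≡ pow₂ (2 * j) [mod pow₂ (suc (2 * j)) ]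
S-odd {k@(suc k-1)} {L = L} {j} 2∣k 1≤k f adjacent =
  mod-modulus (cong (+ 2 *ᶻ_) E²≡2²ʲ)
    (mod-trans (mod-trans (S-near 2E²∣Mⁿ adjacent) (S-odd-below 2∣k 1≤k f)) (mod-reflexive E²≡2²ʲ))
  where
  E = pow₂ j
  M = + suc L
  E²≡2²ʲ : E *ᶻ E ≡ pow₂ (2 * j)
  E²≡2²ʲ = trans (sym (ℤ.^-distribˡ-+-* (+ 2) j j)) (cong (λ i → pow₂ (j + i)) (sym (ℕ.+-identityʳ j)))
  2E²∣Mⁿ : + 2 *ᶻ (E *ᶻ E) ∣ᶻ M ^ᶻ suc k
  2E²∣Mⁿ = subst (_ ∣ᶻ_) (ℤ.*-assoc M M (M ^ᶻ k-1))
             (∣m⇒∣m*n (M ^ᶻ k-1) (∣-trans (divides (+ 2) refl) (square-∣ f)))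

parity : ∀ m → ∃ λ r → m ≡ 2 * r ⊎ m ≡ suc (2 * r)
parity zero = 0 , inj₁ refl
parity (suc m) with parity m
... | r , inj₁ m≡2r = r , inj₂ (cong suc m≡2r)
... | r , inj₂ m≡1+2r = suc r , inj₁ (trans (cong suc m≡1+2r) (sym (ℕ.*-suc 2 r)))

double-odd-times : ∀ {x} w k → x ≡ suc (2 * w) * 2 ^ k → 2 * x ≡ suc (2 * w) * 2 ^ suc k
double-odd-times w k x≡u2ᵏ = trans (cong (2 *_) x≡u2ᵏ) (swap (suc (2 * w)) (2 ^ k))
  where
  swap : ∀ u p → 2 * (u * p) ≡ u * (2 * p)
  swap = ℕ-Ring.solve-∀

odd-part : ∀ x → ∃₂ λ k w → suc x ≡ suc (2 * w) * 2 ^ k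
odd-part = <-rec _ split
  where
  split : ∀ x → (∀ {y} → y < x → ∃₂ λ k w → suc y ≡ suc (2 * w) * 2 ^ k) → ∃₂ λ k w → suc x ≡ suc (2 * w) * 2 ^ k
  split x rec with parity x
  ... | r , inj₁ x≡2r = 0 , r , trans (cong suc x≡2r) (sym (ℕ.*-identityʳ (suc (2 * r))))
  ... | r , inj₂ x≡1+2r with rec (subst (r <_) (sym x≡1+2r) (s≤s (ℕ.m≤m+n r (r + 0))))
  ...   | k , w , 1+r≡u2ᵏ =
          suc k , w , trans (cong suc x≡1+2r) (trans (sym (ℕ.*-suc 2 r)) (double-odd-times w k 1+r≡u2ᵏ))

T-factor : ∀ {m} a b j → m * suc m ≡ 2 * (suc (2 * a) * 2 ^ j) * suc (2 * b) →
           T m ≡ suc (2 * (a + b + 2 * a * b)) * 2 ^ j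
T-factor {m} a b j m[m+1]≡ =
  trans (cong (_/ 2) (trans m[m+1]≡ (collect a b (2 ^ j)))) (m*n/n≡m (suc (2 * (a + b + 2 * a * b)) * 2 ^ j) 2)
  where
  collect : ∀ a b p → 2 * (suc (2 * a) * p) * suc (2 * b) ≡ suc (2 * (a + b + 2 * a * b)) * p * 2
  collect = ℕ-Ring.solve-∀

pow₂-times-odd : ∀ z j → + (suc (2 * z) * 2 ^ j) ≡ pow₂ j [mod pow₂ (suc j) ]
pow₂-times-odd z j = mod-trans
  (mod-reflexive (trans (ℤ.pos-* (suc (2 * z)) (2 ^ j)) (cong₂ _*ᶻ_ (odd-cast z) (pos-^ 2 j))))
  (odd-multiple (+ z) (pow₂ j))

-- The even one of m, m + 1 is M = L + 1 = (2w + 1)·2^(j+1); then v₂(T m) = j.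
record Anchor (m : ℕ) : Set where
  field
    j L : ℕ
    M-factorised : OddTimesPow₂ (suc L) j
    adjacent : m ≡ L ⊎ m ≡ suc L
    T-mod : + T m ≡ pow₂ j [mod pow₂ (suc j) ]

anchor : ∀ m → 1 ≤ m → Anchor m
anchor m 1≤m with parity m
... | zero , inj₁ refl with () ← 1≤m
... | suc r , inj₁ m≡2[1+r] with odd-part r
...   | j , w , 1+r≡u2ʲ = record
  { j = j
  ; L = suc (2 * r)
  ; M-factorised = odd-times-pow₂ w (trans (sym (ℕ.*-suc 2 r)) (double-odd-times w j 1+r≡u2ʲ))
  ; adjacent = inj₂ (trans m≡2[1+r] (ℕ.*-suc 2 r))
  ; T-mod = subst (λ t → + t ≡ pow₂ j [mod pow₂ (suc j) ]) (sym (T-factor {m} w (suc r) j m[m+1]≡))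
                  (pow₂-times-odd (w + suc r + 2 * w * suc r) j)
  }
  where
  m[m+1]≡ : m * suc m ≡ 2 * (suc (2 * w) * 2 ^ j) * suc (2 * suc r)
  m[m+1]≡ = begin
    m * suc m                                   ≡⟨ cong (λ x → x * suc x) m≡2[1+r] ⟩
    2 * suc r * suc (2 * suc r)                 ≡⟨ cong (λ x → 2 * x * suc (2 * suc r)) 1+r≡u2ʲ ⟩
    2 * (suc (2 * w) * 2 ^ j) * suc (2 * suc r) ∎
    where open ≡-Reasoning
anchor m 1≤m | r , inj₂ m≡1+2r with odd-part r
...   | j , w , 1+r≡u2ʲ = record
  { j = j
  ; L = m
  ; M-factorised = odd-times-pow₂ w (trans (cong suc m≡1+2r) (trans (sym (ℕ.*-suc 2 r)) (double-odd-times w j 1+r≡u2ʲ)))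
  ; adjacent = inj₁ refl
  ; T-mod = subst (λ t → + t ≡ pow₂ j [mod pow₂ (suc j) ]) (sym (T-factor {m} w r j m[m+1]≡))
                  (pow₂-times-odd (w + r + 2 * w * r) j)
  }
  where
  m[m+1]≡ : m * suc m ≡ 2 * (suc (2 * w) * 2 ^ j) * suc (2 * r)
  m[m+1]≡ = begin
    m * suc m                                   ≡⟨ ℕ.*-comm m (suc m) ⟩
    suc m * m                                   ≡⟨ cong₂ _*_ (trans (cong suc m≡1+2r) (sym (ℕ.*-suc 2 r))) m≡1+2r ⟩
    2 * suc r * suc (2 * r)                     ≡⟨ cong (λ x → 2 * x * suc (2 * r)) 1+r≡u2ʲ ⟩
    2 * (suc (2 * w) * 2 ^ j) * suc (2 * r)     ∎
    where open ≡-Reasoning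

gauss : ∀ m → m * suc m ≡ S 1 m * 2
gauss zero = refl
gauss (suc m) = begin
  suc m * suc (suc m)            ≡⟨ step m ⟩
  m * suc m + suc m * 2          ≡⟨ cong (_+ suc m * 2) (gauss m) ⟩
  S 1 m * 2 + suc m * 2          ≡⟨ collect (S 1 m) (suc m) ⟩
  (S 1 m + suc m * 1) * 2        ∎
  where
  open ≡-Reasoning
  step : ∀ m → suc m * suc (suc m) ≡ m * suc m + suc m * 2
  step = ℕ-Ring.solve-∀
  collect : ∀ s x → s * 2 + x * 2 ≡ (s + x * 1) * 2
  collect = ℕ-Ring.solve-∀

S₁≡T : ∀ m → S 1 m ≡ T m
S₁≡T m = sym (trans (cong (_/ 2) (gauss m)) (m*n/n≡m (S 1 m) 2))

odd-predecessor : ∀ {n} → 3 ≤ n → ¬ (2 ∣ n) → ∃ λ k → n ≡ suc k × 2 ∣ k × 1 ≤ k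
odd-predecessor {n} 3≤n 2∤n with parity n
... | r , inj₁ n≡2r = ⊥-elim (2∤n (ℕ∣.divides r (trans n≡2r (ℕ.*-comm 2 r))))
... | r , inj₂ n≡1+2r =
  2 * r , n≡1+2r , ℕ∣.divides r (ℕ.*-comm 2 r) , ℕ.≤-trans (s≤s z≤n) (ℕ.≤-pred (subst (3 ≤_) n≡1+2r 3≤n))

theorem1 : (m n : ℕ) → m ≥ 1 → n ≥ 1 → (a b : ℕ) →
    IsVal 2 (S n m) a → IsVal 2 (T m) b →
      ((n ≡ 1 ⊎ 2 ∣ n) → a ≡ b) × ((n ≥ 3 × ¬ (2 ∣ n)) → a ≡ 2 * b)
theorem1 m n m≥1 n≥1 a b v₂Sₙ v₂T = even-or-one , odd-at-least-three
  where
  open Anchor (anchor m m≥1)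
  v₂T≡j : IsVal 2 (T m) j
  v₂T≡j = IsVal-from-mod j T-mod
  b≡j : b ≡ j
  b≡j = IsVal-unique v₂T v₂T≡j
  even-or-one : (n ≡ 1 ⊎ 2 ∣ n) → a ≡ b
  even-or-one (inj₁ refl) =
    trans (IsVal-unique v₂Sₙ (subst (λ t → IsVal 2 t j) (sym (S₁≡T m)) v₂T≡j)) (sym b≡j)
  even-or-one (inj₂ 2∣n) =
    trans (IsVal-unique v₂Sₙ (IsVal-from-mod j (S-even 2∣n n≥1 M-factorised adjacent))) (sym b≡j)
  odd-at-least-three : (n ≥ 3 × ¬ (2 ∣ n)) → a ≡ 2 * b
  odd-at-least-three (n≥3 , 2∤n) with odd-predecessor n≥3 2∤n
  ... | k , refl , 2∣k , 1≤k =
    trans (IsVal-unique v₂Sₙ (IsVal-from-mod (2 * j) (S-odd 2∣k 1≤k M-factorised adjacent))) (cong (2 *_) (sym b≡j))
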